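{- Let $C$ be a constant-free circuit over $\mathbb{Q}$ of size $s$. Then there exist a nonzero integer $M$ with $\tau(M)\le 4s$ and a constant-free division-free algebraic circuit of size at most $4s$ computing the polynomial $M\cdot\widehat C$, where $\widehat C$ is the polynomial computed by $C$.
   Context: An algebraic circuit is a finite DAG whose leaves are labelled by variables or ring constants and whose other nodes are fan-in-two $+$ or $\times$ gates; size = number of nodes. It is constant-free if its constant leaves are only $0,1,-1$. A constant-free circuit over $\mathbb{Q}$ is a constant-free circuit that may additionally contain division gates $u\div v$, where the subcircuit rooted at $v$ contains no variables and computes a nonzero constant. For an integer $M$, $\tau(M)$ is the minimal size of a constant-free division-free circuit (no variables) computing $M$. -}

module Defs where

open import Data.Nat using (ℕ; zero; suc)
open import Data.Fin using (Fin; inject₁)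
open import Data.Vec using (Vec; []; _∷ʳ_; lookup)
open import Data.Bool using (Bool; true; false; _∧_; T)
open import Data.Integer using (ℤ)
open import Data.Rational using (ℚ; 0ℚ; 1ℚ; _+_; _*_; _÷_; -_; _≟_; ≢-nonZero; _/_)
open import Data.Product using (Σ; _×_)
open import Data.Unit using (⊤)
open import Data.Empty using (⊥)
open import Relation.Nullary using (yes; no; ¬_)
open import Relation.Binary.PropositionalEquality using (_≡_; _≢_)

data ConstLeaf : Set where
  c0 c1 c-1 : ConstLeaf

⟦_⟧c : ConstLeaf → ℚ
⟦ c0 ⟧c = 0ℚ
⟦ c1 ⟧c = 1ℚ
⟦ c-1 ⟧c = - 1ℚ

-- A node of a circuit in n variables whose children are among the
-- k previously created nodes (topological order).
data Gate (n k : ℕ) : Set where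
  var  : Fin n → Gate n k
  cst  : ConstLeaf → Gate n k
  add  : Fin k → Fin k → Gate n k
  mul  : Fin k → Fin k → Gate n k
  div  : Fin k → Fin k → Gate n k

data Nodes (n : ℕ) : ℕ → Set where
  []  : Nodes n 0
  _▷_ : ∀ {k} → Nodes n k → Gate n k → Nodes n (suc k)

-- total division; only used where the validity condition guarantees q ≢ 0
divℚ : ℚ → ℚ → ℚ
divℚ p q with q ≟ 0ℚ
... | yes _  = 0ℚ
... | no q≢0 = _÷_ p q {{≢-nonZero q≢0}}

gateVal : ∀ {n k} → Gate n k → Vec ℚ k → (Fin n → ℚ) → ℚ
gateVal (var i)   vs x = x i
gateVal (cst c)   vs x = ⟦ c ⟧c
gateVal (add a b) vs x = lookup vs a + lookup vs b
gateVal (mul a b) vs x = lookup vs a * lookup vs b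
gateVal (div a b) vs x = divℚ (lookup vs a) (lookup vs b)

vals : ∀ {n k} → Nodes n k → (Fin n → ℚ) → Vec ℚ k
vals []      x = []
vals (C ▷ g) x = vals C x ∷ʳ gateVal g (vals C x) x

varFree : ∀ {n k} → Nodes n k → Vec Bool k
varFree []            = []
varFree (C ▷ var i)   = varFree C ∷ʳ false
varFree (C ▷ cst c)   = varFree C ∷ʳ true
varFree (C ▷ add a b) = varFree C ∷ʳ (lookup (varFree C) a ∧ lookup (varFree C) b)
varFree (C ▷ mul a b) = varFree C ∷ʳ (lookup (varFree C) a ∧ lookup (varFree C) b)
varFree (C ▷ div a b) = varFree C ∷ʳ (lookup (varFree C) a ∧ lookup (varFree C) b)

GateOK : ∀ {n k} → Nodes n k → Gate n k → Set
GateOK C (div a b) = T (lookup (varFree C) b) × (∀ x → lookup (vals C x) b ≢ 0ℚ)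
GateOK C _         = ⊤

ValidNodes : ∀ {n k} → Nodes n k → Set
ValidNodes []      = ⊤
ValidNodes (C ▷ g) = ValidNodes C × GateOK C g

DivFreeGate : ∀ {n k} → Gate n k → Set
DivFreeGate (div _ _) = ⊥
DivFreeGate _         = ⊤

DivFreeNodes : ∀ {n k} → Nodes n k → Set
DivFreeNodes []      = ⊤
DivFreeNodes (C ▷ g) = DivFreeNodes C × DivFreeGate g

record Circuit (n : ℕ) : Set where
  constructor circuit
  field
    size  : ℕ
    nodes : Nodes n size
    out   : Fin size
open Circuit public

eval : ∀ {n} → Circuit n → (Fin n → ℚ) → ℚ
eval C x = lookup (vals (nodes C) x) (out C)

-- constant-free circuit over ℚ: divisions only by nonzero variable-free subcircuits
ValidOverℚ : ∀ {n} → Circuit n → Set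
ValidOverℚ C = ValidNodes (nodes C)

DivFree : ∀ {n} → Circuit n → Set
DivFree C = DivFreeNodes (nodes C)

ℤtoℚ : ℤ → ℚ
ℤtoℚ m = m / 1

-- τ(M) ≤ t : some constant-free division-free circuit without variables,
-- of size ≤ t, computes M.
τ≤ : ℤ → ℕ → Set
τ≤ M t = Σ (Circuit 0) λ E → DivFree E × (size E Data.Nat.≤ t) × (∀ x → eval E x ≡ ℤtoℚ M)

-- Evaluate C at every node as a fraction p/q of the node's value: leaves are v/1 and
-- p/q + p'/q' = (pq' + p'q)/(qq'), p/q · p'/q' = pp'/(qq'), (p/q) ÷ (p'/q') = pq'/(qp').
-- Denominators are built from denominators and from numerators of divisors only, and
-- divisors are variable-free, so every q is a nonzero constant. These rules cost four
-- division-free gates per node, giving a circuit of size 4s whose numerator output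
-- computes q · Ĉ. Substituting 0 for the variables turns its denominator output into a
-- variable-free division-free circuit, which computes an integer: that is M = q.

module Submission where

open import Defs
open import Data.Nat using (ℕ; _≤_; _*_)
open import Data.Integer using (ℤ; 0ℤ)
open import Data.Fin using (Fin)
open import Data.Rational using (ℚ) renaming (_*_ to _*ℚ_)
open import Data.Product using (Σ; _×_)
open import Relation.Binary.PropositionalEquality using (_≡_; _≢_)

open import Data.Nat using (zero; suc; _+_)
open import Data.Nat.Properties using (≤-reflexive; *-comm)
import Data.Integer as ℤ
import Data.Integer.Properties as ℤ
open import Data.Fin using (zero; suc; inject₁; fromℕ)
open import Data.Vec using (Vec; []; _∷_; _∷ʳ_; lookup; map)
open import Data.Vec.Properties using (lookup-map; map-∷ʳ)
open import Data.Bool using (Bool; true; false; _∧_; T)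
open import Data.Bool.Properties using (T-∧)
open import Data.Rational using (0ℚ; 1ℚ; 1/_; _≟_; ≢-nonZero; toℚᵘ) renaming (_+_ to _+ℚ_)
import Data.Rational.Properties as ℚ
import Data.Rational.Unnormalised as ℚᵘ
import Data.Rational.Unnormalised.Properties as ℚᵘ
open import Data.Rational.Solver using (module +-*-Solver)
open import Data.Product using (_,_; proj₁; proj₂)
open import Data.Unit using (tt)
open import Data.Empty using (⊥-elim)
open import Function using (_∘_; Equivalence)
open import Relation.Nullary using (yes; no)
open import Relation.Binary.PropositionalEquality
  using (refl; sym; trans; cong; cong₂; module ≡-Reasoning)

open Equivalence using (to)

private
  variable
    A B C : Set
    n k K : ℕ

lookup-∷ʳ-inject₁ : (xs : Vec A k) (y : A) (i : Fin k) → lookup (xs ∷ʳ y) (inject₁ i) ≡ lookup xs i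
lookup-∷ʳ-inject₁ (x ∷ xs) y zero    = refl
lookup-∷ʳ-inject₁ (x ∷ xs) y (suc i) = lookup-∷ʳ-inject₁ xs y i

lookup-∷ʳ-fromℕ : (xs : Vec A k) (y : A) → lookup (xs ∷ʳ y) (fromℕ k) ≡ y
lookup-∷ʳ-fromℕ []       y = refl
lookup-∷ʳ-fromℕ (x ∷ xs) y = lookup-∷ʳ-fromℕ xs y

∷ʳ-pointwise : (R : A → B → Set) (xs : Vec A k) (ys : Vec B k) {x : A} {y : B} →
  (∀ i → R (lookup xs i) (lookup ys i)) → R x y →
  ∀ i → R (lookup (xs ∷ʳ x) i) (lookup (ys ∷ʳ y) i)
∷ʳ-pointwise R []       []       rs r zero    = r
∷ʳ-pointwise R (_ ∷ _)  (_ ∷ _)  rs r zero    = rs zero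
∷ʳ-pointwise R (_ ∷ xs) (_ ∷ ys) rs r (suc i) = ∷ʳ-pointwise R xs ys (rs ∘ suc) r i

∷ʳ-pointwise₃ : (R : A → B → C → Set) (xs : Vec A k) (ys : Vec B k) (zs : Vec C k) {x : A} {y : B} {z : C} →
  (∀ i → R (lookup xs i) (lookup ys i) (lookup zs i)) → R x y z →
  ∀ i → R (lookup (xs ∷ʳ x) i) (lookup (ys ∷ʳ y) i) (lookup (zs ∷ʳ z) i)
∷ʳ-pointwise₃ R []       []       []       rs r zero    = r
∷ʳ-pointwise₃ R (_ ∷ _)  (_ ∷ _)  (_ ∷ _)  rs r zero    = rs zero
∷ʳ-pointwise₃ R (_ ∷ xs) (_ ∷ ys) (_ ∷ zs) rs r (suc i) = ∷ʳ-pointwise₃ R xs ys zs (rs ∘ suc) r i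

*-≢0 : ∀ {p q} → p ≢ 0ℚ → q ≢ 0ℚ → p *ℚ q ≢ 0ℚ
*-≢0 {p} {q} p≢0 q≢0 pq≡0 = p≢0 (begin
  p                  ≡⟨ sym (ℚ.*-identityʳ p) ⟩
  p *ℚ 1ℚ            ≡⟨ cong (p *ℚ_) (sym (ℚ.*-inverseʳ q)) ⟩
  p *ℚ (q *ℚ 1/ q)   ≡⟨ sym (ℚ.*-assoc p q (1/ q)) ⟩
  (p *ℚ q) *ℚ 1/ q   ≡⟨ cong (_*ℚ 1/ q) pq≡0 ⟩
  0ℚ *ℚ 1/ q         ≡⟨ ℚ.*-zeroˡ (1/ q) ⟩
  0ℚ                 ∎)
  where
  open ≡-Reasoning
  instance _ = ≢-nonZero q≢0

divℚ-*-cancel : ∀ p {q} → q ≢ 0ℚ → divℚ p q *ℚ q ≡ p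
divℚ-*-cancel p {q} q≢0 with q ≟ 0ℚ
... | yes q≡0 = ⊥-elim (q≢0 q≡0)
... | no q≢0′ = begin
  (p *ℚ 1/ q) *ℚ q   ≡⟨ ℚ.*-assoc p (1/ q) q ⟩
  p *ℚ (1/ q *ℚ q)   ≡⟨ cong (p *ℚ_) (ℚ.*-inverseˡ q) ⟩
  p *ℚ 1ℚ            ≡⟨ ℚ.*-identityʳ p ⟩
  p                  ∎
  where
  open ≡-Reasoning
  instance _ = ≢-nonZero q≢0′

private
  toℚᵘ-ℤtoℚ : ∀ m → toℚᵘ (ℤtoℚ m) ℚᵘ.≃ ℚᵘ.mkℚᵘ m 0
  toℚᵘ-ℤtoℚ m = ℚ.toℚᵘ-fromℚᵘ (ℚᵘ.mkℚᵘ m 0)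

ℤtoℚ-+ : ∀ a b → ℤtoℚ (a ℤ.+ b) ≡ ℤtoℚ a +ℚ ℤtoℚ b
ℤtoℚ-+ a b = ℚ.toℚᵘ-injective (ℚᵘ.≃-trans (toℚᵘ-ℤtoℚ (a ℤ.+ b)) (ℚᵘ.≃-trans integral
  (ℚᵘ.≃-sym (ℚᵘ.≃-trans (ℚ.toℚᵘ-homo-+ (ℤtoℚ a) (ℤtoℚ b)) (ℚᵘ.+-cong (toℚᵘ-ℤtoℚ a) (toℚᵘ-ℤtoℚ b))))))
  where
  integral : ℚᵘ.mkℚᵘ (a ℤ.+ b) 0 ℚᵘ.≃ ℚᵘ.mkℚᵘ a 0 ℚᵘ.+ ℚᵘ.mkℚᵘ b 0
  integral = ℚᵘ.*≡* (cong (ℤ._* ℤ.1ℤ) (sym (cong₂ ℤ._+_ (ℤ.*-identityʳ a) (ℤ.*-identityʳ b))))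

ℤtoℚ-* : ∀ a b → ℤtoℚ (a ℤ.* b) ≡ ℤtoℚ a *ℚ ℤtoℚ b
ℤtoℚ-* a b = ℚ.toℚᵘ-injective (ℚᵘ.≃-trans (toℚᵘ-ℤtoℚ (a ℤ.* b))
  (ℚᵘ.≃-sym (ℚᵘ.≃-trans (ℚ.toℚᵘ-homo-* (ℤtoℚ a) (ℤtoℚ b)) (ℚᵘ.*-cong (toℚᵘ-ℤtoℚ a) (toℚᵘ-ℤtoℚ b)))))

record Frac : Set where
  constructor _⁄_
  field
    num den : ℚ
open Frac

infix 8 _⁄_
infixl 6 _+ᶠ_
infixl 7 _*ᶠ_ _÷ᶠ_

_+ᶠ_ _*ᶠ_ _÷ᶠ_ : Frac → Frac → Frac
(pa ⁄ qa) +ᶠ (pb ⁄ qb) = (pa *ℚ qb +ℚ pb *ℚ qa) ⁄ (qa *ℚ qb)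
(pa ⁄ qa) *ᶠ (pb ⁄ qb) = (pa *ℚ pb) ⁄ (qa *ℚ qb)
(pa ⁄ qa) ÷ᶠ (pb ⁄ qb) = (pa *ℚ qb) ⁄ (qa *ℚ pb)

record Represents (v : ℚ) (f : Frac) : Set where
  constructor represents
  field
    num≡ : num f ≡ v *ℚ den f
    den≢0 : den f ≢ 0ℚ
open Represents

⁄1-represents : ∀ v → Represents v (v ⁄ 1ℚ)
⁄1-represents v = represents (sym (ℚ.*-identityʳ v)) ℚ.1≢0

+ᶠ-represents : ∀ {va vb fa fb} → Represents va fa → Represents vb fb → Represents (va +ℚ vb) (fa +ᶠ fb)
+ᶠ-represents {va} {vb} {pa ⁄ qa} {pb ⁄ qb} (represents pa≡ qa≢0) (represents pb≡ qb≢0) = represents (begin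
  pa *ℚ qb +ℚ pb *ℚ qa                    ≡⟨ cong₂ _+ℚ_ (cong (_*ℚ qb) pa≡) (cong (_*ℚ qa) pb≡) ⟩
  (va *ℚ qa) *ℚ qb +ℚ (vb *ℚ qb) *ℚ qa    ≡⟨ distribute va vb qa qb ⟩
  (va +ℚ vb) *ℚ (qa *ℚ qb)                ∎) (*-≢0 qa≢0 qb≢0)
  where
  open ≡-Reasoning
  open +-*-Solver
  distribute : ∀ va vb qa qb → (va *ℚ qa) *ℚ qb +ℚ (vb *ℚ qb) *ℚ qa ≡ (va +ℚ vb) *ℚ (qa *ℚ qb)
  distribute = solve 4 (λ va vb qa qb → (va :* qa) :* qb :+ (vb :* qb) :* qa := (va :+ vb) :* (qa :* qb)) refl

*ᶠ-represents : ∀ {va vb fa fb} → Represents va fa → Represents vb fb → Represents (va *ℚ vb) (fa *ᶠ fb)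
*ᶠ-represents {va} {vb} {pa ⁄ qa} {pb ⁄ qb} (represents pa≡ qa≢0) (represents pb≡ qb≢0) = represents (begin
  pa *ℚ pb                    ≡⟨ cong₂ _*ℚ_ pa≡ pb≡ ⟩
  (va *ℚ qa) *ℚ (vb *ℚ qb)    ≡⟨ regroup va vb qa qb ⟩
  (va *ℚ vb) *ℚ (qa *ℚ qb)    ∎) (*-≢0 qa≢0 qb≢0)
  where
  open ≡-Reasoning
  open +-*-Solver
  regroup : ∀ va vb qa qb → (va *ℚ qa) *ℚ (vb *ℚ qb) ≡ (va *ℚ vb) *ℚ (qa *ℚ qb)
  regroup = solve 4 (λ va vb qa qb → (va :* qa) :* (vb :* qb) := (va :* vb) :* (qa :* qb)) refl

÷ᶠ-represents : ∀ {va vb fa fb} → vb ≢ 0ℚ → Represents va fa → Represents vb fb → Represents (divℚ va vb) (fa ÷ᶠ fb)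
÷ᶠ-represents {va} {vb} {pa ⁄ qa} {pb ⁄ qb} vb≢0 (represents pa≡ qa≢0) (represents pb≡ qb≢0) = represents (begin
  pa *ℚ qb                     ≡⟨ cong (_*ℚ qb) pa≡ ⟩
  (va *ℚ qa) *ℚ qb             ≡⟨ ℚ.*-assoc va qa qb ⟩
  va *ℚ (qa *ℚ qb)             ≡⟨ cong (_*ℚ (qa *ℚ qb)) (sym (divℚ-*-cancel va vb≢0)) ⟩
  (w *ℚ vb) *ℚ (qa *ℚ qb)      ≡⟨ regroup w vb qa qb ⟩
  w *ℚ (qa *ℚ (vb *ℚ qb))      ≡⟨ cong (λ p → w *ℚ (qa *ℚ p)) (sym pb≡) ⟩
  w *ℚ (qa *ℚ pb)              ∎) (*-≢0 qa≢0 pb≢0)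
  where
  open ≡-Reasoning
  open +-*-Solver
  w : ℚ
  w = divℚ va vb
  regroup : ∀ w vb qa qb → (w *ℚ vb) *ℚ (qa *ℚ qb) ≡ w *ℚ (qa *ℚ (vb *ℚ qb))
  regroup = solve 4 (λ w vb qa qb → (w :* vb) :* (qa :* qb) := w :* (qa :* (vb :* qb))) refl
  pb≢0 : pb ≢ 0ℚ
  pb≢0 pb≡0 = *-≢0 vb≢0 qb≢0 (trans (sym pb≡) pb≡0)

fracGate : Gate n k → Vec Frac k → (Fin n → ℚ) → Frac
fracGate (var i)   fs x = x i ⁄ 1ℚ
fracGate (cst c)   fs x = ⟦ c ⟧c ⁄ 1ℚ
fracGate (add a b) fs x = lookup fs a +ᶠ lookup fs b
fracGate (mul a b) fs x = lookup fs a *ᶠ lookup fs b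
fracGate (div a b) fs x = lookup fs a ÷ᶠ lookup fs b

fracs : Nodes n k → (Fin n → ℚ) → Vec Frac k
fracs []      x = []
fracs (C ▷ g) x = fracs C x ∷ʳ fracGate g (fracs C x) x

fracGate-represents : (C : Nodes n k) (g : Gate n k) (x : Fin n → ℚ) → GateOK C g →
  (∀ i → Represents (lookup (vals C x) i) (lookup (fracs C x) i)) →
  Represents (gateVal g (vals C x) x) (fracGate g (fracs C x) x)
fracGate-represents C (var i)   x _          rep = ⁄1-represents (x i)
fracGate-represents C (cst c)   x _          rep = ⁄1-represents ⟦ c ⟧c
fracGate-represents C (add a b) x _          rep = +ᶠ-represents (rep a) (rep b)
fracGate-represents C (mul a b) x _          rep = *ᶠ-represents (rep a) (rep b)
fracGate-represents C (div a b) x (_ , b≢0) rep = ÷ᶠ-represents (b≢0 x) (rep a) (rep b)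

fracs-represent : (C : Nodes n k) → ValidNodes C → ∀ x i → Represents (lookup (vals C x) i) (lookup (fracs C x) i)
fracs-represent []      _            x ()
fracs-represent (C ▷ g) (valid , ok) x =
  ∷ʳ-pointwise Represents (vals C x) (fracs C x) rep (fracGate-represents C g x ok rep)
  where rep = fracs-represent C valid x

varFreeGate : Gate n k → Vec Bool k → Bool
varFreeGate (var _)   vf = false
varFreeGate (cst _)   vf = true
varFreeGate (add a b) vf = lookup vf a ∧ lookup vf b
varFreeGate (mul a b) vf = lookup vf a ∧ lookup vf b
varFreeGate (div a b) vf = lookup vf a ∧ lookup vf b

varFree-▷ : (C : Nodes n k) (g : Gate n k) → varFree (C ▷ g) ≡ varFree C ∷ʳ varFreeGate g (varFree C)
varFree-▷ C (var _)   = refl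
varFree-▷ C (cst _)   = refl
varFree-▷ C (add _ _) = refl
varFree-▷ C (mul _ _) = refl
varFree-▷ C (div _ _) = refl

record Agree (varFree : Bool) (f f′ : Frac) : Set where
  constructor agree
  field
    same-den : den f ≡ den f′
    same-num : T varFree → num f ≡ num f′
open Agree

fracGate-agree : (C : Nodes n k) (g : Gate n k) (x y : Fin n → ℚ) → GateOK C g →
  (∀ i → Agree (lookup (varFree C) i) (lookup (fracs C x) i) (lookup (fracs C y) i)) →
  Agree (varFreeGate g (varFree C)) (fracGate g (fracs C x) x) (fracGate g (fracs C y) y)
fracGate-agree C (var i)   x y _ ag = agree refl λ ()
fracGate-agree C (cst c)   x y _ ag = agree refl λ _ → refl
fracGate-agree C (add a b) x y _ ag = agree (cong₂ _*ℚ_ (same-den (ag a)) (same-den (ag b))) λ t →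
  let ta , tb = to T-∧ t in
  cong₂ _+ℚ_ (cong₂ _*ℚ_ (same-num (ag a) ta) (same-den (ag b))) (cong₂ _*ℚ_ (same-num (ag b) tb) (same-den (ag a)))
fracGate-agree C (mul a b) x y _ ag = agree (cong₂ _*ℚ_ (same-den (ag a)) (same-den (ag b))) λ t →
  let ta , tb = to T-∧ t in
  cong₂ _*ℚ_ (same-num (ag a) ta) (same-num (ag b) tb)
fracGate-agree C (div a b) x y (b-varFree , _) ag = agree (cong₂ _*ℚ_ (same-den (ag a)) (same-num (ag b) b-varFree)) λ t →
  cong₂ _*ℚ_ (same-num (ag a) (proj₁ (to T-∧ t))) (same-den (ag b))

fracs-agree : (C : Nodes n k) → ValidNodes C → ∀ x y i →
  Agree (lookup (varFree C) i) (lookup (fracs C x) i) (lookup (fracs C y) i)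
fracs-agree []      _            x y ()
fracs-agree (C ▷ g) (valid , ok) x y rewrite varFree-▷ C g =
  ∷ʳ-pointwise₃ Agree (varFree C) (fracs C x) (fracs C y) ag (fracGate-agree C g x y ok ag)
  where ag = fracs-agree C valid x y

weaken : Gate n K → Gate n (suc K)
weaken (var i)   = var i
weaken (cst c)   = cst c
weaken (add a b) = add (inject₁ a) (inject₁ b)
weaken (mul a b) = mul (inject₁ a) (inject₁ b)
weaken (div a b) = div (inject₁ a) (inject₁ b)

gateVal-weaken : (g : Gate n K) (vs : Vec ℚ K) (v : ℚ) (x : Fin n → ℚ) →
  gateVal (weaken g) (vs ∷ʳ v) x ≡ gateVal g vs x
gateVal-weaken (var i)   vs v x = refl
gateVal-weaken (cst c)   vs v x = refl
gateVal-weaken (add a b) vs v x = cong₂ _+ℚ_ (lookup-∷ʳ-inject₁ vs v a) (lookup-∷ʳ-inject₁ vs v b)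
gateVal-weaken (mul a b) vs v x = cong₂ _*ℚ_ (lookup-∷ʳ-inject₁ vs v a) (lookup-∷ʳ-inject₁ vs v b)
gateVal-weaken (div a b) vs v x = cong₂ divℚ (lookup-∷ʳ-inject₁ vs v a) (lookup-∷ʳ-inject₁ vs v b)

record Block (n K : ℕ) : Set where
  constructor block
  field
    first  : Gate n K
    second : Gate n (1 + K)
    third  : Gate n (2 + K)
    fourth : Gate n (3 + K)

infixl 5 _▷▷_

_▷▷_ : Nodes n K → Block n K → Nodes n (4 + K)
E ▷▷ block g₁ g₂ g₃ g₄ = (((E ▷ g₁) ▷ g₂) ▷ g₃) ▷ g₄

old : Fin K → Fin (4 + K)
old = inject₁ ∘ inject₁ ∘ inject₁ ∘ inject₁

firstNode : ∀ K → Fin (4 + K)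
firstNode K = inject₁ (inject₁ (inject₁ (fromℕ K)))

lastNode : ∀ K → Fin (4 + K)
lastNode K = fromℕ (3 + K)

module _ (E : Nodes n K) (B : Block n K) (x : Fin n → ℚ) where
  open Block B
  private
    V₀ = vals E x
    V₁ = vals (E ▷ first) x
    V₂ = vals ((E ▷ first) ▷ second) x
    V₃ = vals (((E ▷ first) ▷ second) ▷ third) x
    V₄ = vals (E ▷▷ B) x

  lookup-▷▷-old : ∀ j → lookup V₄ (old j) ≡ lookup V₀ j
  lookup-▷▷-old j = begin
    lookup V₄ (old j)                                ≡⟨ lookup-∷ʳ-inject₁ V₃ _ _ ⟩
    lookup V₃ (inject₁ (inject₁ (inject₁ j)))        ≡⟨ lookup-∷ʳ-inject₁ V₂ _ _ ⟩
    lookup V₂ (inject₁ (inject₁ j))                  ≡⟨ lookup-∷ʳ-inject₁ V₁ _ _ ⟩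
    lookup V₁ (inject₁ j)                            ≡⟨ lookup-∷ʳ-inject₁ V₀ _ _ ⟩
    lookup V₀ j                                      ∎
    where open ≡-Reasoning

  lookup-▷▷-first : lookup V₄ (firstNode K) ≡ gateVal first V₀ x
  lookup-▷▷-first = begin
    lookup V₄ (firstNode K)                          ≡⟨ lookup-∷ʳ-inject₁ V₃ _ _ ⟩
    lookup V₃ (inject₁ (inject₁ (fromℕ K)))          ≡⟨ lookup-∷ʳ-inject₁ V₂ _ _ ⟩
    lookup V₂ (inject₁ (fromℕ K))                    ≡⟨ lookup-∷ʳ-inject₁ V₁ _ _ ⟩
    lookup V₁ (fromℕ K)                              ≡⟨ lookup-∷ʳ-fromℕ V₀ _ ⟩
    gateVal first V₀ x                                  ∎
    where open ≡-Reasoning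

  lookup-▷▷-second : lookup V₃ (inject₁ (fromℕ (1 + K))) ≡ gateVal second V₁ x
  lookup-▷▷-second = trans (lookup-∷ʳ-inject₁ V₂ _ _) (lookup-∷ʳ-fromℕ V₁ _)

  lookup-▷▷-third : lookup V₃ (fromℕ (2 + K)) ≡ gateVal third V₂ x
  lookup-▷▷-third = lookup-∷ʳ-fromℕ V₂ _

  lookup-▷▷-last : lookup V₄ (lastNode K) ≡ gateVal fourth V₃ x
  lookup-▷▷-last = lookup-∷ʳ-fromℕ V₃ _

gateVal-weaken² : (g : Gate n K) (vs : Vec ℚ K) (u v : ℚ) (x : Fin n → ℚ) →
  gateVal (weaken (weaken g)) ((vs ∷ʳ u) ∷ʳ v) x ≡ gateVal g vs x
gateVal-weaken² g vs u v x = trans (gateVal-weaken (weaken g) (vs ∷ʳ u) v x) (gateVal-weaken g vs u x)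

gateVal-weaken³ : (g : Gate n K) (vs : Vec ℚ K) (u v w : ℚ) (x : Fin n → ℚ) →
  gateVal (weaken (weaken (weaken g))) (((vs ∷ʳ u) ∷ʳ v) ∷ʳ w) x ≡ gateVal g vs x
gateVal-weaken³ g vs u v w x = trans (gateVal-weaken (weaken (weaken g)) ((vs ∷ʳ u) ∷ʳ v) w x) (gateVal-weaken² g vs u v x)

-- A node of C takes four nodes, its denominator first and its numerator last; the
-- padding by constants 0 makes the size exactly four times that of C.
encodeGate : Gate n k → (ps qs : Vec (Fin K) k) → Block n K
encodeGate (var i) ps qs = block (cst c1) (cst c0) (cst c0) (var i)
encodeGate (cst c) ps qs = block (cst c1) (cst c0) (cst c0) (cst c)
encodeGate {K = K} (add a b) ps qs =
  block (mul (lookup qs a) (lookup qs b)) (weaken (mul (lookup ps a) (lookup qs b)))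
        (weaken (weaken (mul (lookup ps b) (lookup qs a)))) (add (inject₁ (fromℕ (1 + K))) (fromℕ (2 + K)))
encodeGate (mul a b) ps qs =
  block (mul (lookup qs a) (lookup qs b)) (cst c0) (cst c0) (weaken (weaken (weaken (mul (lookup ps a) (lookup ps b)))))
encodeGate (div a b) ps qs =
  block (mul (lookup qs a) (lookup ps b)) (cst c0) (cst c0) (weaken (weaken (weaken (mul (lookup ps a) (lookup qs b)))))

record Encodes (V : Vec ℚ K) (p q : Fin K) (f : Frac) : Set where
  constructor encodes
  field
    at-num : lookup V p ≡ num f
    at-den : lookup V q ≡ den f
open Encodes

encodeGate-correct : (g : Gate n k) (E : Nodes n K) (ps qs : Vec (Fin K) k) (fs : Vec Frac k) (x : Fin n → ℚ) →
  (∀ i → Encodes (vals E x) (lookup ps i) (lookup qs i) (lookup fs i)) →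
  Encodes (vals (E ▷▷ encodeGate g ps qs) x) (lastNode K) (firstNode K) (fracGate g fs x)
encodeGate-correct (var i) E ps qs fs x enc =
  encodes (lookup-▷▷-last E β x) (lookup-▷▷-first E β x)
  where β = encodeGate (var i) ps qs
encodeGate-correct (cst c) E ps qs fs x enc =
  encodes (lookup-▷▷-last E β x) (lookup-▷▷-first E β x)
  where β = encodeGate (cst c) ps qs
encodeGate-correct {K = K} (add a b) E ps qs fs x enc = encodes
  (begin
    lookup (vals (E ▷▷ β) x) (lastNode K)     ≡⟨ lookup-▷▷-last E β x ⟩
    lookup V₃ (inject₁ (fromℕ (1 + K))) +ℚ lookup V₃ (fromℕ (2 + K))
                                              ≡⟨ cong₂ _+ℚ_
                                                   (trans (lookup-▷▷-second E β x) (gateVal-weaken pa·qb V _ x))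
                                                   (trans (lookup-▷▷-third E β x) (gateVal-weaken² pb·qa V _ _ x)) ⟩
    gateVal pa·qb V x +ℚ gateVal pb·qa V x    ≡⟨ cong₂ _+ℚ_ (cong₂ _*ℚ_ (at-num (enc a)) (at-den (enc b)))
                                                            (cong₂ _*ℚ_ (at-num (enc b)) (at-den (enc a))) ⟩
    num (fracGate (add a b) fs x)             ∎)
  (trans (lookup-▷▷-first E β x) (cong₂ _*ℚ_ (at-den (enc a)) (at-den (enc b))))
  where
  open ≡-Reasoning
  β = encodeGate (add a b) ps qs
  V = vals E x
  V₃ = vals (((E ▷ Block.first β) ▷ Block.second β) ▷ Block.third β) x
  pa·qb = mul (lookup ps a) (lookup qs b)
  pb·qa = mul (lookup ps b) (lookup qs a)
encodeGate-correct (mul a b) E ps qs fs x enc = encodes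
  (trans (lookup-▷▷-last E β x) (trans (gateVal-weaken³ (mul (lookup ps a) (lookup ps b)) (vals E x) _ _ _ x) (cong₂ _*ℚ_ (at-num (enc a)) (at-num (enc b)))))
  (trans (lookup-▷▷-first E β x) (cong₂ _*ℚ_ (at-den (enc a)) (at-den (enc b))))
  where β = encodeGate (mul a b) ps qs
encodeGate-correct (div a b) E ps qs fs x enc = encodes
  (trans (lookup-▷▷-last E β x) (trans (gateVal-weaken³ (mul (lookup ps a) (lookup qs b)) (vals E x) _ _ _ x) (cong₂ _*ℚ_ (at-num (enc a)) (at-den (enc b)))))
  (trans (lookup-▷▷-first E β x) (cong₂ _*ℚ_ (at-den (enc a)) (at-num (enc b))))
  where β = encodeGate (div a b) ps qs

record Encoding (n k : ℕ) : Set where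
  constructor encoding
  field
    target       : Nodes n (k * 4)
    numerators   : Vec (Fin (k * 4)) k
    denominators : Vec (Fin (k * 4)) k
open Encoding

encode : Nodes n k → Encoding n k
encode []                  = encoding [] [] []
encode {k = suc k} (C ▷ g) = encoding (target E ▷▷ encodeGate g (numerators E) (denominators E))
  (map old (numerators E) ∷ʳ lastNode (k * 4)) (map old (denominators E) ∷ʳ firstNode (k * 4))
  where E = encode C

encode-correct : (C : Nodes n k) (x : Fin n → ℚ) → let E = encode C in
  ∀ i → Encodes (vals (target E) x) (lookup (numerators E) i) (lookup (denominators E) i) (lookup (fracs C x) i)
encode-correct []      x ()
encode-correct (C ▷ g) x = ∷ʳ-pointwise₃ (Encodes V′) (map old ps) (map old qs) (fracs C x) preserved
  (encodeGate-correct g (target E) ps qs (fracs C x) x (encode-correct C x))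
  where
  E  = encode C
  ps = numerators E
  qs = denominators E
  V′ = vals (target E ▷▷ encodeGate g ps qs) x
  preserved : ∀ i → Encodes V′ (lookup (map old ps) i) (lookup (map old qs) i) (lookup (fracs C x) i)
  preserved i = encodes (trans (stays ps i) (at-num (encode-correct C x i))) (trans (stays qs i) (at-den (encode-correct C x i)))
    where
    stays : ∀ ns i → lookup V′ (lookup (map old ns) i) ≡ lookup (vals (target E) x) (lookup ns i)
    stays ns i = trans (cong (lookup V′) (lookup-map i old ns)) (lookup-▷▷-old (target E) (encodeGate g ps qs) x (lookup ns i))

encodeGate-divFree : (g : Gate n k) (ps qs : Vec (Fin K) k) (E : Nodes n K) →
  DivFreeNodes E → DivFreeNodes (E ▷▷ encodeGate g ps qs)
encodeGate-divFree (var _)   ps qs E d = (((d , tt) , tt) , tt) , tt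
encodeGate-divFree (cst _)   ps qs E d = (((d , tt) , tt) , tt) , tt
encodeGate-divFree (add _ _) ps qs E d = (((d , tt) , tt) , tt) , tt
encodeGate-divFree (mul _ _) ps qs E d = (((d , tt) , tt) , tt) , tt
encodeGate-divFree (div _ _) ps qs E d = (((d , tt) , tt) , tt) , tt

encode-divFree : (C : Nodes n k) → DivFreeNodes (target (encode C))
encode-divFree []      = tt
encode-divFree (C ▷ g) = encodeGate-divFree g _ _ _ (encode-divFree C)

zeroVarsGate : Gate n k → Gate 0 k
zeroVarsGate (var _)   = cst c0
zeroVarsGate (cst c)   = cst c
zeroVarsGate (add a b) = add a b
zeroVarsGate (mul a b) = mul a b
zeroVarsGate (div a b) = div a b

zeroVars : Nodes n k → Nodes 0 k
zeroVars []      = []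
zeroVars (E ▷ g) = zeroVars E ▷ zeroVarsGate g

gateVal-zeroVarsGate : (g : Gate n k) (vs : Vec ℚ k) (y : Fin 0 → ℚ) →
  gateVal (zeroVarsGate g) vs y ≡ gateVal g vs (λ _ → 0ℚ)
gateVal-zeroVarsGate (var _)   vs y = refl
gateVal-zeroVarsGate (cst _)   vs y = refl
gateVal-zeroVarsGate (add _ _) vs y = refl
gateVal-zeroVarsGate (mul _ _) vs y = refl
gateVal-zeroVarsGate (div _ _) vs y = refl

vals-zeroVars : (E : Nodes n k) (y : Fin 0 → ℚ) → vals (zeroVars E) y ≡ vals E (λ _ → 0ℚ)
vals-zeroVars []      y = refl
vals-zeroVars (E ▷ g) y rewrite vals-zeroVars E y = cong (vals E _ ∷ʳ_) (gateVal-zeroVarsGate g _ y)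

zeroVars-divFree : (E : Nodes n k) → DivFreeNodes E → DivFreeNodes (zeroVars E)
zeroVars-divFree []            _        = tt
zeroVars-divFree (E ▷ var _)   (d , _)  = zeroVars-divFree E d , tt
zeroVars-divFree (E ▷ cst _)   (d , _)  = zeroVars-divFree E d , tt
zeroVars-divFree (E ▷ add _ _) (d , _)  = zeroVars-divFree E d , tt
zeroVars-divFree (E ▷ mul _ _) (d , _)  = zeroVars-divFree E d , tt
zeroVars-divFree (E ▷ div _ _) (_ , ())

constℤ : ConstLeaf → ℤ
constℤ c0  = 0ℤ
constℤ c1  = ℤ.1ℤ
constℤ c-1 = ℤ.-1ℤ

gateValℤ : (g : Gate 0 k) → DivFreeGate g → Vec ℤ k → ℤ
gateValℤ (cst c)   _ ms = constℤ c
gateValℤ (add a b) _ ms = lookup ms a ℤ.+ lookup ms b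
gateValℤ (mul a b) _ ms = lookup ms a ℤ.* lookup ms b

valsℤ : (E : Nodes 0 k) → DivFreeNodes E → Vec ℤ k
valsℤ []      _        = []
valsℤ (E ▷ g) (d , dg) = valsℤ E d ∷ʳ gateValℤ g dg (valsℤ E d)

gateVal-ℤtoℚ : (g : Gate 0 k) (dg : DivFreeGate g) (ms : Vec ℤ k) (y : Fin 0 → ℚ) →
  gateVal g (map ℤtoℚ ms) y ≡ ℤtoℚ (gateValℤ g dg ms)
gateVal-ℤtoℚ (cst c0)  _ ms y = refl
gateVal-ℤtoℚ (cst c1)  _ ms y = refl
gateVal-ℤtoℚ (cst c-1) _ ms y = refl
gateVal-ℤtoℚ (add a b) _ ms y =
  trans (cong₂ _+ℚ_ (lookup-map a ℤtoℚ ms) (lookup-map b ℤtoℚ ms)) (sym (ℤtoℚ-+ (lookup ms a) (lookup ms b)))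
gateVal-ℤtoℚ (mul a b) _ ms y =
  trans (cong₂ _*ℚ_ (lookup-map a ℤtoℚ ms) (lookup-map b ℤtoℚ ms)) (sym (ℤtoℚ-* (lookup ms a) (lookup ms b)))

vals-valsℤ : (E : Nodes 0 k) (d : DivFreeNodes E) (y : Fin 0 → ℚ) → vals E y ≡ map ℤtoℚ (valsℤ E d)
vals-valsℤ []      _        y = refl
vals-valsℤ (E ▷ g) (d , dg) y = begin
  vals E y ∷ʳ gateVal g (vals E y) y            ≡⟨ cong (λ vs → vs ∷ʳ gateVal g vs y) (vals-valsℤ E d y) ⟩
  map ℤtoℚ ms ∷ʳ gateVal g (map ℤtoℚ ms) y      ≡⟨ cong (map ℤtoℚ ms ∷ʳ_) (gateVal-ℤtoℚ g dg ms y) ⟩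
  map ℤtoℚ ms ∷ʳ ℤtoℚ (gateValℤ g dg ms)        ≡⟨ sym (map-∷ʳ ℤtoℚ _ ms) ⟩
  map ℤtoℚ (ms ∷ʳ gateValℤ g dg ms)             ∎
  where
  open ≡-Reasoning
  ms = valsℤ E d

divFree-closed-integral : (Z : Circuit 0) → DivFree Z → Σ ℤ λ M → ∀ y → eval Z y ≡ ℤtoℚ M
divFree-closed-integral (circuit k Z o) d = lookup (valsℤ Z d) o , λ y →
  trans (cong (λ vs → lookup vs o) (vals-valsℤ Z d y)) (lookup-map o ℤtoℚ (valsℤ Z d))

origin : Fin n → ℚ
origin _ = 0ℚ

-- By fracs-agree the denominator does not depend on the point, so we read it at 0.
denominator : Nodes n k → Fin k → ℚ
denominator C o = den (lookup (fracs C origin) o)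

denominator-≢0 : (C : Nodes n k) → ValidNodes C → ∀ o → denominator C o ≢ 0ℚ
denominator-≢0 C valid o = den≢0 (fracs-represent C valid origin o)

encode-numerator : (C : Nodes n k) → ValidNodes C → ∀ o x →
  lookup (vals (target (encode C)) x) (lookup (numerators (encode C)) o) ≡ lookup (vals C x) o *ℚ denominator C o
encode-numerator C valid o x = begin
  lookup (vals (target (encode C)) x) (lookup (numerators (encode C)) o) ≡⟨ at-num (encode-correct C x o) ⟩
  num (lookup (fracs C x) o)                                           ≡⟨ num≡ (fracs-represent C valid x o) ⟩
  lookup (vals C x) o *ℚ den (lookup (fracs C x) o)                    ≡⟨ cong (lookup (vals C x) o *ℚ_) (same-den (fracs-agree C valid x origin o)) ⟩
  lookup (vals C x) o *ℚ denominator C o                               ∎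
  where open ≡-Reasoning

zeroVars-encode-denominator : (C : Nodes n k) → ∀ o y →
  lookup (vals (zeroVars (target (encode C))) y) (lookup (denominators (encode C)) o) ≡ denominator C o
zeroVars-encode-denominator C o y =
  trans (cong (λ vs → lookup vs (lookup (denominators (encode C)) o)) (vals-zeroVars (target (encode C)) y))
        (at-den (encode-correct C origin o))

proposition3p3 : ∀ {n : ℕ} (C : Circuit n) → ValidOverℚ C →
    Σ ℤ λ M → (M ≢ 0ℤ) × τ≤ M (4 * size C) ×
      Σ (Circuit n) λ D → DivFree D × (size D ≤ 4 * size C) ×
        (∀ (x : Fin n → ℚ) → eval D x ≡ ℤtoℚ M *ℚ eval C x)
proposition3p3 {n} (circuit k C o) valid =
  M , M≢0 , (Z , divFree-Z , size-bound , Z≡M) , (D , encode-divFree C , size-bound , D≡M*C)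
  where
  E : Encoding n k
  E = encode C
  D : Circuit n
  D = circuit (k * 4) (target E) (lookup (numerators E) o)
  Z : Circuit 0
  Z = circuit (k * 4) (zeroVars (target E)) (lookup (denominators E) o)
  divFree-Z : DivFree Z
  divFree-Z = zeroVars-divFree (target E) (encode-divFree C)
  M : ℤ
  M = proj₁ (divFree-closed-integral Z divFree-Z)
  Z≡M : ∀ y → eval Z y ≡ ℤtoℚ M
  Z≡M = proj₂ (divFree-closed-integral Z divFree-Z)
  M≡denominator : ℤtoℚ M ≡ denominator C o
  M≡denominator = trans (sym (Z≡M λ ())) (zeroVars-encode-denominator C o λ ())
  M≢0 : M ≢ 0ℤ
  M≢0 M≡0 = denominator-≢0 C valid o (trans (sym M≡denominator) (cong ℤtoℚ M≡0))
  size-bound : k * 4 ≤ 4 * k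
  size-bound = ≤-reflexive (*-comm k 4)
  D≡M*C : ∀ x → eval D x ≡ ℤtoℚ M *ℚ eval (circuit k C o) x
  D≡M*C x = trans (encode-numerator C valid o x)
    (trans (cong (lookup (vals C x) o *ℚ_) (sym M≡denominator)) (ℚ.*-comm (lookup (vals C x) o) (ℤtoℚ M)))
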